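{- Let $f:\{0,1\}^n\to\{0,1\}$ be a symmetric function, let $U$ be a certificate utility function for $f$, and let $S$ be an elementary (deterministic) testing strategy for $f$. Let $R$ be a (randomized) pruning of $S$. Then there exists a (randomized) pruning $R'$ of $S$ that is elementary and satisfies $\mathbb{E}[\mathrm{cost}(R)]=\mathbb{E}[\mathrm{cost}(R')]$ and $\mathbb{E}[U(R)]=\mathbb{E}[U(R')]$.
   Context: The variables $x_1,\dots,x_n$ are independent Boolean random variables with known $\Pr[x_i=1]=p_i$. A function $f$ is symmetric if $f(x)$ depends only on $\sum_i x_i$. A deterministic testing strategy is a binary decision tree. Internal nodes test variables, each variable appears at most once per root-leaf path, and leaves mean stopping. A randomized strategy is a distribution over deterministic ones. $\mathrm{cost}(S)$ is the random number of tests performed. A strategy is elementary if its decisions (which variable to test next, whether to stop, and its internal random choices) depend only on the numbers of $0$s and of $1$s observed so far and on its internal randomness. A (deterministic) pruning of $S$ is obtained by making $S$ stop at some nodes, i.e., by replacing subtrees with leaves. A randomized pruning is obtained by sequences of operations each of which, at some node, stops with some probability $\alpha$ and otherwise continues as before. Equivalently, it is a distribution over deterministic prunings of $S$. A partial assignment is $\sigma\in\{0,1,*\}^n$; it is an $\ell$-certificate of $f$ if all its full extensions evaluate to $\ell$. For a fixed $L\subseteq\{0,1\}$, the certificate utility function $U$ assigns utility $1$ to partial assignments that are $\ell$-certificates for some $\ell\in L$, and utility $0$ otherwise. $U(S)$ denotes the utility of the random partial assignment produced by running $S$.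
   Formalization: The probabilities $p_i$ and the weights of the randomized pruning R are rational. -}

module Defs where

open import Data.Nat using (ℕ; zero; suc)
open import Data.Fin using (Fin)
open import Data.Bool using (Bool; true; false; _≟_)
open import Data.Maybe using (Maybe; just; nothing)
open import Data.Vec using (Vec; []; _∷_; _[_]≔_; replicate)
open import Data.Vec.Relation.Binary.Pointwise.Inductive as PW using (Pointwise)
open import Data.List using (List; []; _∷_; map; foldr)
open import Data.List.Membership.Propositional using (_∈_)
open import Data.List.Relation.Unary.All using (All)
open import Data.Product using (Σ; _×_; _,_; ∃; proj₁; proj₂)
open import Data.Unit using (⊤; tt)
open import Relation.Nullary using (¬_; Dec; yes; no)
open import Relation.Nullary.Decidable using (map′; _×-dec_; _→-dec_; _⊎-dec_; does)
open import Relation.Binary.PropositionalEquality using (_≡_; refl)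
open import Data.Sum using (_⊎_)
open import Data.Rational using (ℚ; 0ℚ; 1ℚ; _+_; _*_; _-_; _≤_)

ones : ∀ {n} → Vec Bool n → ℕ
ones []           = zero
ones (true  ∷ xs) = suc (ones xs)
ones (false ∷ xs) = ones xs

Symmetric : ∀ {n} → (Vec Bool n → Bool) → Set
Symmetric f = ∀ x y → ones x ≡ ones y → f x ≡ f y

-- Partial assignments and certificates
-- A partial assignment is a vector over Maybe Bool (nothing = *).

PartialAssignment : ℕ → Set
PartialAssignment n = Vec (Maybe Bool) n

Agree : Bool → Maybe Bool → Set
Agree b nothing  = ⊤
Agree b (just c) = b ≡ c

agree? : ∀ b m → Dec (Agree b m)
agree? b nothing  = yes tt
agree? b (just c) = b ≟ c

Extends : ∀ {n} → Vec Bool n → PartialAssignment n → Set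
Extends x σ = Pointwise Agree x σ

IsCertificate : ∀ {n} → (Vec Bool n → Bool) → Bool → PartialAssignment n → Set
IsCertificate f ℓ σ = ∀ x → Extends x σ → f x ≡ ℓ

∀Vec? : ∀ {n} {P : Vec Bool n → Set} → (∀ x → Dec (P x)) → Dec (∀ x → P x)
∀Vec? {zero}  {P} d = map′ (λ { p [] → p }) (λ h → h []) (d [])
∀Vec? {suc n} {P} d =
  map′ (λ { (pf , pt) (false ∷ x) → pf x ; (pf , pt) (true ∷ x) → pt x })
       (λ h → (λ x → h (false ∷ x)) , (λ x → h (true ∷ x)))
       (∀Vec? (λ x → d (false ∷ x)) ×-dec ∀Vec? (λ x → d (true ∷ x)))

isCertificate? : ∀ {n} (f : Vec Bool n → Bool) ℓ σ → Dec (IsCertificate f ℓ σ)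
isCertificate? f ℓ σ = ∀Vec? (λ x → PW.decidable agree? x σ →-dec (f x ≟ ℓ))

-- L ⊆ {0,1} is given by its membership function.
-- Certificate utility: 1 if σ is an ℓ-certificate for some ℓ ∈ L, else 0.
CertUtil : ∀ {n} → (Vec Bool n → Bool) → (Bool → Bool) → PartialAssignment n → Set
CertUtil f L σ = Σ Bool λ ℓ → L ℓ ≡ true × IsCertificate f ℓ σ

certUtil? : ∀ {n} (f : Vec Bool n → Bool) L σ → Dec (CertUtil f L σ)
certUtil? f L σ =
  map′ (λ { (inj₁ (e , c)) → false , e , c ; (inj₂ (e , c)) → true , e , c })
       (λ { (false , e , c) → inj₁ (e , c) ; (true , e , c) → inj₂ (e , c) })
       ((L false ≟ true ×-dec isCertificate? f false σ)
          ⊎-dec (L true ≟ true ×-dec isCertificate? f true σ))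
  where open import Data.Sum using (inj₁; inj₂)

utility : ∀ {n} → (Vec Bool n → Bool) → (Bool → Bool) → PartialAssignment n → ℚ
utility f L σ with does (certUtil? f L σ)
... | true  = 1ℚ
... | false = 0ℚ

-- node i t₀ t₁ : test x_i; continue with t₀ if x_i = 0, with t₁ if x_i = 1.
data Tree (n : ℕ) : Set where
  leaf : Tree n
  node : Fin n → Tree n → Tree n → Tree n

ValidFrom : ∀ {n} → List (Fin n) → Tree n → Set
ValidFrom used leaf           = ⊤
ValidFrom used (node i t₀ t₁) =
  ¬ (i ∈ used) × ValidFrom (i ∷ used) t₀ × ValidFrom (i ∷ used) t₁

Valid : ∀ {n} → Tree n → Set
Valid t = ValidFrom [] t

-- elementary: which variable to test / whether to stop depends only on
-- (#0s observed, #1s observed), via a rule g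
ElemFrom : ∀ {n} → (ℕ → ℕ → Maybe (Fin n)) → ℕ → ℕ → Tree n → Set
ElemFrom g a b leaf           = g a b ≡ nothing
ElemFrom g a b (node i t₀ t₁) =
  g a b ≡ just i × ElemFrom g (suc a) b t₀ × ElemFrom g a (suc b) t₁

Elementary : ∀ {n} → Tree n → Set
Elementary {n} t = Σ (ℕ → ℕ → Maybe (Fin n)) λ g → ElemFrom g 0 0 t

data Prunes {n : ℕ} : Tree n → Tree n → Set where
  stop : ∀ {t} → Prunes leaf t
  cont : ∀ {i t₀ t₁ u₀ u₁} → Prunes u₀ t₀ → Prunes u₁ t₁ →
         Prunes (node i u₀ u₁) (node i t₀ t₁)

-- Expectations under independent x_i with Pr[x_i = 1] = p i

expCostFrom : ∀ {n} → (Fin n → ℚ) → Tree n → ℚ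
expCostFrom p leaf           = 0ℚ
expCostFrom p (node i t₀ t₁) =
  1ℚ + ((1ℚ - p i) * expCostFrom p t₀ + p i * expCostFrom p t₁)

expUtilFrom : ∀ {n} → (Fin n → ℚ) → (PartialAssignment n → ℚ) →
              PartialAssignment n → Tree n → ℚ
expUtilFrom p U σ leaf           = U σ
expUtilFrom p U σ (node i t₀ t₁) =
  (1ℚ - p i) * expUtilFrom p U (σ [ i ]≔ just false) t₀
    + p i * expUtilFrom p U (σ [ i ]≔ just true) t₁

sumℚ : List ℚ → ℚ
sumℚ = foldr _+_ 0ℚ

record RandPruning {n : ℕ} (S : Tree n) : Set where
  field
    support   : List (ℚ × Tree n)
    nonneg    : All (λ wt → 0ℚ ≤ proj₁ wt) support
    total     : sumℚ (map proj₁ support) ≡ 1ℚ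
    isPruning : All (λ wt → Prunes (proj₂ wt) S) support

open RandPruning public

-- elementary randomized strategy: a distribution over elementary deterministic
-- strategies (internal randomness drawn up front)
ElementaryRand : ∀ {n} {S : Tree n} → RandPruning S → Set
ElementaryRand R = All (λ wt → Elementary (proj₂ wt)) (support R)

ExpCost : ∀ {n} {S : Tree n} → (Fin n → ℚ) → RandPruning S → ℚ
ExpCost p R = sumℚ (map (λ wt → proj₁ wt * expCostFrom p (proj₂ wt)) (support R))

ExpUtil : ∀ {n} {S : Tree n} → (Fin n → ℚ) → (Vec Bool n → Bool) → (Bool → Bool) →
          RandPruning S → ℚ
ExpUtil {n} p f L R =
  sumℚ (map (λ wt → proj₁ wt * expUtilFrom p (utility f L) (replicate n nothing) (proj₂ wt))
           (support R))

-- Since S follows a rule g of the layer (a , b) = (number of 0s, number of 1s observed),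
-- the part of S below a node depends only on the layer of the node.  Expected cost and,
-- f being symmetric, expected utility are both values of the form "k per test plus
-- h a b on stopping at layer (a , b)".  Fix a layer.  Replacing a pruning T by the
-- mixture, over the nodes v of T on the layer weighted by the probability of reaching v,
-- of T with every node of the layer replaced by the subtree of T at v, preserves all
-- such values, because the value of T is affine in the tree grafted at the layer.  Each
-- resulting pruning stops at all or at none of its nodes on the layer, and layers
-- treated before stay so.  Once every layer of S is treated, each pruning stops by a
-- rule of the layer alone, i.e. it is elementary.
{-# OPTIONS --safe #-}
module Submission where

open import Defs
open import Function using (_∘_)
open import Data.Unit using (tt)
open import Data.Bool using (Bool; true; false; if_then_else_)
open import Data.Maybe using (Maybe; just; nothing)
open import Data.Product as Product using (Σ; _×_; _,_; proj₁; proj₂; map₁)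
open import Data.Sum as Sum using (_⊎_; inj₁; inj₂)
open import Data.Nat as ℕ using (ℕ; zero; suc; z≤n; s≤s)
import Data.Nat.Properties as ℕ
open import Data.Fin as Fin using (Fin)
open import Data.Rational using (ℚ; 0ℚ; 1ℚ; _≤_; _+_; _*_; _-_; -_; 1/_; ≢-nonZero; nonNegative)
import Data.Rational.Properties as ℚ
open import Data.Rational.Solver using (module +-*-Solver)
open +-*-Solver
open import Data.List using (List; []; _∷_; [_]; _++_; map; concatMap)
open import Data.List.Membership.Propositional using (_∈_)
open import Data.List.Membership.Propositional.Properties using (∈-++⁺ˡ; ∈-++⁺ʳ)
open import Data.List.Relation.Unary.All as All using (All; []; _∷_)
open import Data.List.Relation.Unary.All.Properties using (++⁺; map⁺; concat⁺)
open import Data.List.Relation.Unary.Any using (here; there)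
open import Data.Vec using (Vec; []; _∷_; _[_]≔_; replicate; lookup)
open import Data.Vec.Properties using (lookup∘updateAt′; lookup-replicate)
open import Data.Vec.Relation.Binary.Pointwise.Inductive using ([]; _∷_)
open import Relation.Nullary using (¬_; Dec; yes; no; _×-dec_; contradiction)
open import Relation.Binary.PropositionalEquality hiding ([_])

0≤1 : 0ℚ ≤ 1ℚ
0≤1 = ℚ.nonNegative⁻¹ 1ℚ

*-nonNeg : ∀ {a b} → 0ℚ ≤ a → 0ℚ ≤ b → 0ℚ ≤ a * b
*-nonNeg {a} {b} 0≤a 0≤b =
  ℚ.nonNegative⁻¹ (a * b) {{ℚ.nonNeg*nonNeg⇒nonNeg a {{nonNegative 0≤a}} b {{nonNegative 0≤b}}}}

+-nonNeg : ∀ {a b} → 0ℚ ≤ a → 0ℚ ≤ b → 0ℚ ≤ a + b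
+-nonNeg {a} {b} 0≤a 0≤b = subst (_≤ a + b) (ℚ.+-identityˡ 0ℚ) (ℚ.+-mono-≤ 0≤a 0≤b)

1-nonNeg : ∀ {a} → a ≤ 1ℚ → 0ℚ ≤ 1ℚ - a
1-nonNeg {a} a≤1 = subst (_≤ 1ℚ - a) (ℚ.+-inverseʳ a) (ℚ.+-monoˡ-≤ (- a) a≤1)

+-nonNeg-≡0 : ∀ {a b} → 0ℚ ≤ a → 0ℚ ≤ b → a + b ≡ 0ℚ → a ≡ 0ℚ × b ≡ 0ℚ
+-nonNeg-≡0 {a} {b} 0≤a 0≤b a+b≡0 =
    ℚ.≤-antisym (subst₂ _≤_ (ℚ.+-identityʳ a) a+b≡0 (ℚ.+-monoʳ-≤ a 0≤b)) 0≤a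
  , ℚ.≤-antisym (subst₂ _≤_ (ℚ.+-identityˡ b) a+b≡0 (ℚ.+-monoˡ-≤ b 0≤a)) 0≤b

1/-nonNeg : ∀ {a} (a≢0 : a ≢ 0ℚ) → 0ℚ ≤ a → 0ℚ ≤ (1/ a) {{≢-nonZero a≢0}}
1/-nonNeg {a} a≢0 0≤a = ℚ.nonNegative⁻¹ a⁻¹ {{ℚ.pos⇒nonNeg a⁻¹ {{ℚ.1/pos⇒pos a {{a>0}}}}}}
  where
  a⁻¹ = (1/ a) {{≢-nonZero a≢0}}
  a>0 = ℚ.nonNeg∧nonZero⇒pos a {{nonNegative 0≤a}} {{≢-nonZero a≢0}}

module _ {A : Set} where

  expectation : (A → ℚ) → List (ℚ × A) → ℚ
  expectation F l = sumℚ (map (λ wa → proj₁ wa * F (proj₂ wa)) l)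

  totalWeight : List (ℚ × A) → ℚ
  totalWeight = expectation (λ _ → 1ℚ)

  scale : ℚ → List (ℚ × A) → List (ℚ × A)
  scale c = map (map₁ (c *_))

  NonNegWeights : List (ℚ × A) → Set
  NonNegWeights = All (λ wa → 0ℚ ≤ proj₁ wa)

  sumℚ-weights≡totalWeight : ∀ l → sumℚ (map proj₁ l) ≡ totalWeight l
  sumℚ-weights≡totalWeight []            = refl
  sumℚ-weights≡totalWeight ((w , a) ∷ l) =
    cong₂ _+_ (sym (ℚ.*-identityʳ w)) (sumℚ-weights≡totalWeight l)

  expectation-++ : ∀ F l₁ l₂ → expectation F (l₁ ++ l₂) ≡ expectation F l₁ + expectation F l₂
  expectation-++ F []             l₂ = sym (ℚ.+-identityˡ _)
  expectation-++ F ((w , a) ∷ l₁) l₂ = begin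
    w * F a + expectation F (l₁ ++ l₂)                 ≡⟨ cong (w * F a +_) (expectation-++ F l₁ l₂) ⟩
    w * F a + (expectation F l₁ + expectation F l₂)    ≡⟨ ℚ.+-assoc (w * F a) _ _ ⟨
    w * F a + expectation F l₁ + expectation F l₂      ∎
    where open ≡-Reasoning

  expectation-scale : ∀ F c l → expectation F (scale c l) ≡ c * expectation F l
  expectation-scale F c []            = sym (ℚ.*-zeroʳ c)
  expectation-scale F c ((w , a) ∷ l) rewrite expectation-scale F c l =
    solve 4 (λ c w v e → c :* w :* v :+ c :* e := c :* (w :* v :+ e)) refl c w (F a) (expectation F l)

  expectation-cong : ∀ {F G} l → All (λ wa → F (proj₂ wa) ≡ G (proj₂ wa)) l →
                     expectation F l ≡ expectation G l
  expectation-cong []            []           = refl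
  expectation-cong ((w , a) ∷ l) (Fa≡Ga ∷ eqs) = cong₂ (λ u v → w * u + v) Fa≡Ga (expectation-cong l eqs)

  expectation-concatMap : ∀ F (k : ℚ × A → List (ℚ × A)) →
                          (∀ wa → expectation F (k wa) ≡ proj₁ wa * F (proj₂ wa)) →
                          ∀ l → expectation F (concatMap k l) ≡ expectation F l
  expectation-concatMap F k hk []        = refl
  expectation-concatMap F k hk (wa ∷ l) = begin
    expectation F (k wa ++ concatMap k l)             ≡⟨ expectation-++ F (k wa) (concatMap k l) ⟩
    expectation F (k wa) + expectation F (concatMap k l) ≡⟨ cong₂ _+_ (hk wa) (expectation-concatMap F k hk l) ⟩
    proj₁ wa * F (proj₂ wa) + expectation F l         ∎
    where open ≡-Reasoning

  totalWeight-nonNeg : ∀ {l} → NonNegWeights l → 0ℚ ≤ totalWeight l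
  totalWeight-nonNeg []                  = ℚ.≤-refl
  totalWeight-nonNeg {(w , _) ∷ _} (0≤w ∷ ws) =
    +-nonNeg (subst (0ℚ ≤_) (sym (ℚ.*-identityʳ w)) 0≤w) (totalWeight-nonNeg ws)

  expectation-weightless : ∀ F {l} → NonNegWeights l → totalWeight l ≡ 0ℚ → expectation F l ≡ 0ℚ
  expectation-weightless F []                          _  = refl
  expectation-weightless F {(w , a) ∷ l} (0≤w ∷ ws) W≡0
    with +-nonNeg-≡0 (subst (0ℚ ≤_) (sym (ℚ.*-identityʳ w)) 0≤w) (totalWeight-nonNeg ws) W≡0
  ... | w1≡0 , rest≡0 = begin
    w * F a + expectation F l  ≡⟨ cong₂ (λ u v → u * F a + v) w≡0 (expectation-weightless F ws rest≡0) ⟩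
    0ℚ * F a + 0ℚ             ≡⟨ solve 1 (λ v → con 0ℚ :* v :+ con 0ℚ := con 0ℚ) refl (F a) ⟩
    0ℚ                        ∎
    where
    open ≡-Reasoning
    w≡0 : w ≡ 0ℚ
    w≡0 = trans (sym (ℚ.*-identityʳ w)) w1≡0

  scale-All : ∀ {P : A → Set} c {l} → All (P ∘ proj₂) l → All (P ∘ proj₂) (scale c l)
  scale-All c []       = []
  scale-All c (q ∷ qs) = q ∷ scale-All c qs

  scale-nonNeg : ∀ {c l} → 0ℚ ≤ c → NonNegWeights l → NonNegWeights (scale c l)
  scale-nonNeg 0≤c []          = []
  scale-nonNeg 0≤c (0≤w ∷ ws) = *-nonNeg 0≤c 0≤w ∷ scale-nonNeg 0≤c ws

isLeaf : ∀ {n} → Tree n → Bool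
isLeaf leaf         = true
isLeaf (node _ _ _) = false

UniformAt : ∀ {n} → ℕ → ℕ → Bool → ℕ → ℕ → Tree n → Set
UniformAt x y s a b leaf           = a ≡ x × b ≡ y → s ≡ true
UniformAt x y s a b (node _ t₀ t₁) =
  (a ≡ x × b ≡ y → s ≡ false) × UniformAt x y s (suc a) b t₀ × UniformAt x y s a (suc b) t₁

beyond⇒offLayer : ∀ {x y a b} → x ℕ.< a ⊎ y ℕ.< b → ¬ (a ≡ x × b ≡ y)
beyond⇒offLayer (inj₁ x<a) (refl , _) = ℕ.<-irrefl refl x<a
beyond⇒offLayer (inj₂ y<b) (_ , refl) = ℕ.<-irrefl refl y<b

uniformAt-beyond : ∀ {n x y s a b} (t : Tree n) → x ℕ.< a ⊎ y ℕ.< b → UniformAt x y s a b t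
uniformAt-beyond leaf           beyond on = contradiction on (beyond⇒offLayer beyond)
uniformAt-beyond (node _ t₀ t₁) beyond =
    (λ on → contradiction on (beyond⇒offLayer beyond))
  , uniformAt-beyond t₀ (Sum.map₁ ℕ.m<n⇒m<1+n beyond)
  , uniformAt-beyond t₁ (Sum.map₂ ℕ.m<n⇒m<1+n beyond)

uniformAt-root : ∀ {n} x y (X : Tree n) → UniformAt x y (isLeaf X) x y X
uniformAt-root x y leaf           _ = refl
uniformAt-root x y (node _ X₀ X₁) =
  (λ _ → refl) , uniformAt-beyond X₀ (inj₁ (ℕ.n<1+n x)) , uniformAt-beyond X₁ (inj₂ (ℕ.n<1+n y))

UniformBy : ∀ {n} → (ℕ → ℕ → Bool) → List (ℕ × ℕ) → ℕ → ℕ → Tree n → Set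
UniformBy r layers a b t = ∀ {x y} → (x , y) ∈ layers → UniformAt x y (r x y) a b t

uniformBy-children : ∀ {n r layers a b} i {t₀ t₁ : Tree n} → UniformBy r layers a b (node i t₀ t₁) →
                     UniformBy r layers (suc a) b t₀ × UniformBy r layers a (suc b) t₁
uniformBy-children _ u = (λ m → proj₁ (proj₂ (u m))) , (λ m → proj₂ (proj₂ (u m)))

PrunesFollowing : ∀ {n} → (ℕ → ℕ → Maybe (Fin n)) → ℕ → ℕ → Tree n → Set
PrunesFollowing g a b t = Σ _ λ Y → ElemFrom g a b Y × Prunes t Y

prunesFollowing-children : ∀ {n g a b} i {t₀ t₁ : Tree n} → PrunesFollowing g a b (node i t₀ t₁) →
                           PrunesFollowing g (suc a) b t₀ × PrunesFollowing g a (suc b) t₁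
prunesFollowing-children _ (node _ Y₀ Y₁ , (_ , e₀ , e₁) , cont t₀≼Y₀ t₁≼Y₁) =
  (Y₀ , e₀ , t₀≼Y₀) , (Y₁ , e₁ , t₁≼Y₁)

elemFrom-unique : ∀ {n g a b} {S S′ : Tree n} → ElemFrom g a b S → ElemFrom g a b S′ → S ≡ S′
elemFrom-unique {S = leaf}         {leaf}         _ _ = refl
elemFrom-unique {S = leaf}         {node _ _ _}   ends (goes , _) with trans (sym ends) goes
... | ()
elemFrom-unique {S = node _ _ _}   {leaf}         (goes , _) ends with trans (sym ends) goes
... | ()
elemFrom-unique {S = node i _ _}   {node _ _ _}   (goes , e₀ , e₁) (goes′ , e₀′ , e₁′)
  with trans (sym goes) goes′
... | refl = cong₂ (node i) (elemFrom-unique e₀ e₀′) (elemFrom-unique e₁ e₁′)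

layersFrom : ∀ {n} → ℕ → ℕ → Tree n → List (ℕ × ℕ)
layersFrom a b leaf           = [ (a , b) ]
layersFrom a b (node _ t₀ t₁) = (a , b) ∷ layersFrom (suc a) b t₀ ++ layersFrom a (suc b) t₁

root∈layersFrom : ∀ {n} a b (t : Tree n) → (a , b) ∈ layersFrom a b t
root∈layersFrom a b leaf         = here refl
root∈layersFrom a b (node _ _ _) = here refl

stopWhen : ∀ {n} → (ℕ → ℕ → Bool) → (ℕ → ℕ → Maybe (Fin n)) → ℕ → ℕ → Maybe (Fin n)
stopWhen r g a b = if r a b then nothing else g a b

elemFrom-stopWhen : ∀ {n g r a b} {T S : Tree n} → Prunes T S → ElemFrom g a b S →
                    UniformBy r (layersFrom a b S) a b T → ElemFrom (stopWhen r g) a b T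
elemFrom-stopWhen {a = a} {b} {S = S} stop _ uT
  rewrite uT (root∈layersFrom a b S) (refl , refl) = refl
elemFrom-stopWhen (cont T₀≼S₀ T₁≼S₁) (g≡i , eS₀ , eS₁) uT
  rewrite proj₁ (uT (here refl)) (refl , refl) =
    g≡i
  , elemFrom-stopWhen T₀≼S₀ eS₀ (λ m → proj₁ (proj₂ (uT (there (∈-++⁺ˡ m)))))
  , elemFrom-stopWhen T₁≼S₁ eS₁ (λ m → proj₂ (proj₂ (uT (there (∈-++⁺ʳ _ m)))))

validFrom-prune : ∀ {n} {used : List (Fin n)} {T S} → Prunes T S → ValidFrom used S → ValidFrom used T
validFrom-prune stop                _                      = tt
validFrom-prune (cont T₀≼S₀ T₁≼S₁) (i∉ , valid₀ , valid₁) =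
  i∉ , validFrom-prune T₀≼S₀ valid₀ , validFrom-prune T₁≼S₁ valid₁

module Layered {n : ℕ} (p : Fin n → ℚ) where

  value : (ℕ → ℕ → ℚ) → ℚ → ℕ → ℕ → Tree n → ℚ
  value h k a b leaf           = h a b
  value h k a b (node i t₀ t₁) =
    k + ((1ℚ - p i) * value h k (suc a) b t₀ + p i * value h k a (suc b) t₁)

  value-cong : ∀ {h k a a′ b b′} t → a ≡ a′ × b ≡ b′ → value h k a b t ≡ value h k a′ b′ t
  value-cong t (refl , refl) = refl

  value-one : ∀ a b t → value (λ _ _ → 1ℚ) 0ℚ a b t ≡ 1ℚ
  value-one a b leaf           = refl
  value-one a b (node i t₀ t₁) rewrite value-one (suc a) b t₀ | value-one a (suc b) t₁ =
    solve 1 (λ q → con 0ℚ :+ ((con 1ℚ :- q) :* con 1ℚ :+ q :* con 1ℚ) := con 1ℚ) refl (p i)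

  expCostFrom≡value : ∀ a b t → expCostFrom p t ≡ value (λ _ _ → 0ℚ) 1ℚ a b t
  expCostFrom≡value a b leaf           = refl
  expCostFrom≡value a b (node i t₀ t₁) =
    cong₂ (λ u v → 1ℚ + ((1ℚ - p i) * u + p i * v))
          (expCostFrom≡value (suc a) b t₀) (expCostFrom≡value a (suc b) t₁)

  module AtLayer (x y : ℕ) where

    onLayer? : ∀ a b → Dec (a ≡ x × b ≡ y)
    onLayer? a b = (a ℕ.≟ x) ×-dec (b ℕ.≟ y)

    subtreesAt : ℕ → ℕ → Tree n → List (ℚ × Tree n)
    subtreesAt a b t with onLayer? a b
    ... | yes _ = [ (1ℚ , t) ]
    subtreesAt a b leaf           | no _ = []
    subtreesAt a b (node i t₀ t₁) | no _ =
      scale (1ℚ - p i) (subtreesAt (suc a) b t₀) ++ scale (p i) (subtreesAt a (suc b) t₁)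

    valueOutside : (ℕ → ℕ → ℚ) → ℚ → ℕ → ℕ → Tree n → ℚ
    valueOutside h k a b t with onLayer? a b
    ... | yes _ = 0ℚ
    valueOutside h k a b leaf           | no _ = h a b
    valueOutside h k a b (node i t₀ t₁) | no _ =
      k + ((1ℚ - p i) * valueOutside h k (suc a) b t₀ + p i * valueOutside h k a (suc b) t₁)

    graftAt : Tree n → ℕ → ℕ → Tree n → Tree n
    graftAt X a b t with onLayer? a b
    ... | yes _ = X
    graftAt X a b leaf           | no _ = leaf
    graftAt X a b (node i t₀ t₁) | no _ = node i (graftAt X (suc a) b t₀) (graftAt X a (suc b) t₁)

    module _ (h : ℕ → ℕ → ℚ) (k : ℚ) where

      value-split : ∀ a b t →
        value h k a b t ≡ valueOutside h k a b t + expectation (value h k x y) (subtreesAt a b t)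
      value-split a b t with onLayer? a b
      ... | yes (refl , refl) =
        solve 1 (λ v → v := con 0ℚ :+ (con 1ℚ :* v :+ con 0ℚ)) refl (value h k x y t)
      value-split a b leaf           | no _ = sym (ℚ.+-identityʳ _)
      value-split a b (node i t₀ t₁) | no _
        rewrite value-split (suc a) b t₀ | value-split a (suc b) t₁
              | expectation-++ (value h k x y) (scale (1ℚ - p i) (subtreesAt (suc a) b t₀))
                                               (scale (p i) (subtreesAt a (suc b) t₁))
              | expectation-scale (value h k x y) (1ℚ - p i) (subtreesAt (suc a) b t₀)
              | expectation-scale (value h k x y) (p i) (subtreesAt a (suc b) t₁) =
        solve 6 (λ k q r₀ s₀ r₁ s₁ → k :+ ((con 1ℚ :- q) :* (r₀ :+ s₀) :+ q :* (r₁ :+ s₁))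
                    := (k :+ ((con 1ℚ :- q) :* r₀ :+ q :* r₁)) :+ ((con 1ℚ :- q) :* s₀ :+ q :* s₁))
              refl k (p i) (valueOutside h k (suc a) b t₀) (expectation (value h k x y) (subtreesAt (suc a) b t₀))
                           (valueOutside h k a (suc b) t₁) (expectation (value h k x y) (subtreesAt a (suc b) t₁))

      value-graftAt : ∀ X a b t →
        value h k a b (graftAt X a b t) ≡ valueOutside h k a b t + totalWeight (subtreesAt a b t) * value h k x y X
      value-graftAt X a b t with onLayer? a b
      ... | yes (refl , refl) =
        solve 1 (λ v → v := con 0ℚ :+ ((con 1ℚ :* con 1ℚ :+ con 0ℚ) :* v)) refl (value h k x y X)
      value-graftAt X a b leaf           | no _ =
        solve 2 (λ u v → u := u :+ con 0ℚ :* v) refl (h a b) (value h k x y X)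
      value-graftAt X a b (node i t₀ t₁) | no _
        rewrite value-graftAt X (suc a) b t₀ | value-graftAt X a (suc b) t₁
              | expectation-++ (λ _ → 1ℚ) (scale (1ℚ - p i) (subtreesAt (suc a) b t₀))
                                          (scale (p i) (subtreesAt a (suc b) t₁))
              | expectation-scale (λ _ → 1ℚ) (1ℚ - p i) (subtreesAt (suc a) b t₀)
              | expectation-scale (λ _ → 1ℚ) (p i) (subtreesAt a (suc b) t₁) =
        solve 7 (λ k q r₀ w₀ r₁ w₁ v → k :+ ((con 1ℚ :- q) :* (r₀ :+ w₀ :* v) :+ q :* (r₁ :+ w₁ :* v))
                    := (k :+ ((con 1ℚ :- q) :* r₀ :+ q :* r₁)) :+ ((con 1ℚ :- q) :* w₀ :+ q :* w₁) :* v)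
              refl k (p i) (valueOutside h k (suc a) b t₀) (totalWeight (subtreesAt (suc a) b t₀))
                           (valueOutside h k a (suc b) t₁) (totalWeight (subtreesAt a (suc b) t₁)) (value h k x y X)

    subtreesAt-nonNeg : (∀ i → 0ℚ ≤ p i × p i ≤ 1ℚ) → ∀ a b t → NonNegWeights (subtreesAt a b t)
    subtreesAt-nonNeg p∈[0,1] a b t with onLayer? a b
    ... | yes _ = 0≤1 ∷ []
    subtreesAt-nonNeg p∈[0,1] a b leaf           | no _ = []
    subtreesAt-nonNeg p∈[0,1] a b (node i t₀ t₁) | no _ =
      ++⁺ (scale-nonNeg (1-nonNeg (proj₂ (p∈[0,1] i))) (subtreesAt-nonNeg p∈[0,1] (suc a) b t₀))
          (scale-nonNeg (proj₁ (p∈[0,1] i)) (subtreesAt-nonNeg p∈[0,1] a (suc b) t₁))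

    subtreesAt-inherit : (P : ℕ → ℕ → Tree n → Set) →
      (∀ {a b} i {t₀ t₁} → P a b (node i t₀ t₁) → P (suc a) b t₀ × P a (suc b) t₁) →
      ∀ a b t → P a b t → All (P x y ∘ proj₂) (subtreesAt a b t)
    subtreesAt-inherit P inherit a b t Pt with onLayer? a b
    ... | yes (refl , refl) = Pt ∷ []
    subtreesAt-inherit P inherit a b leaf           Pt | no _ = []
    subtreesAt-inherit P inherit a b (node i t₀ t₁) Pt | no _ =
      ++⁺ (scale-All (1ℚ - p i) (subtreesAt-inherit P inherit (suc a) b t₀ (proj₁ (inherit i Pt))))
          (scale-All (p i) (subtreesAt-inherit P inherit a (suc b) t₁ (proj₂ (inherit i Pt))))

    graftAt-uniformizes : ∀ X a b t → UniformAt x y (isLeaf X) a b (graftAt X a b t)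
    graftAt-uniformizes X a b t with onLayer? a b
    ... | yes (refl , refl) = uniformAt-root x y X
    graftAt-uniformizes X a b leaf           | no off = λ on → contradiction on off
    graftAt-uniformizes X a b (node i t₀ t₁) | no off =
        (λ on → contradiction on off)
      , graftAt-uniformizes X (suc a) b t₀
      , graftAt-uniformizes X a (suc b) t₁

    graftAt-preserves-uniformAt : ∀ {x′ y′ s} X a b t → UniformAt x′ y′ s x y X →
                                  UniformAt x′ y′ s a b t → UniformAt x′ y′ s a b (graftAt X a b t)
    graftAt-preserves-uniformAt X a b t uX ut with onLayer? a b
    ... | yes (refl , refl) = uX
    graftAt-preserves-uniformAt X a b leaf           uX ut              | no _ = ut
    graftAt-preserves-uniformAt X a b (node i t₀ t₁) uX (ur , ut₀ , ut₁) | no _ =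
      ur , graftAt-preserves-uniformAt X (suc a) b t₀ uX ut₀ , graftAt-preserves-uniformAt X a (suc b) t₁ uX ut₁

    module _ (g : ℕ → ℕ → Maybe (Fin n)) where

      -- By elemFrom-unique, Y is the subtree of S rooted on layer (x , y) when S follows g.
      PrunesOnLayer : Tree n → Set
      PrunesOnLayer X = ∀ {Y} → ElemFrom g x y Y → Prunes X Y

      graftAt-prunes : ∀ {X} a b t {S} → PrunesOnLayer X → ElemFrom g a b S → Prunes t S →
                       Prunes (graftAt X a b t) S
      graftAt-prunes a b t X≼ eS t≼S with onLayer? a b
      ... | yes (refl , refl) = X≼ eS
      graftAt-prunes a b leaf           X≼ eS                stop               | no _ = stop
      graftAt-prunes a b (node i t₀ t₁) X≼ (_ , eS₀ , eS₁) (cont t₀≼S₀ t₁≼S₁) | no _ =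
        cont (graftAt-prunes (suc a) b t₀ X≼ eS₀ t₀≼S₀) (graftAt-prunes a (suc b) t₁ X≼ eS₁ t₁≼S₁)

      subtreesAt-prunes : ∀ a b t → PrunesFollowing g a b t → All (PrunesOnLayer ∘ proj₂) (subtreesAt a b t)
      subtreesAt-prunes a b t t≼ =
        All.map (λ { (Y , eY , X≼Y) eY′ → subst (Prunes _) (elemFrom-unique eY eY′) X≼Y })
                (subtreesAt-inherit (PrunesFollowing g) prunesFollowing-children a b t t≼)

module Mixing {n : ℕ} (p : Fin n → ℚ) (p∈[0,1] : ∀ i → 0ℚ ≤ p i × p i ≤ 1ℚ)
              (g : ℕ → ℕ → Maybe (Fin n)) {S : Tree n} (eS : ElemFrom g 0 0 S) where
  open Layered p

  UniformOn : List (ℕ × ℕ) → Tree n → Set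
  UniformOn layers T = Σ (ℕ → ℕ → Bool) λ r → UniformBy r layers 0 0 T

  Admissible : List (ℕ × ℕ) → ℚ × Tree n → Set
  Admissible layers (w , T) = 0ℚ ≤ w × Prunes T S × UniformOn layers T

  module _ (x y : ℕ) where
    open AtLayer x y

    graftEach : ℚ → Tree n → List (ℚ × Tree n) → List (ℚ × Tree n)
    graftEach d T = map (λ uX → d * proj₁ uX , graftAt (proj₂ uX) 0 0 T)

    mixAt : ℚ × Tree n → List (ℚ × Tree n)
    mixAt (w , T) with totalWeight (subtreesAt 0 0 T) ℚ.≟ 0ℚ
    ... | yes _  = [ (w , graftAt leaf 0 0 T) ]
    ... | no W≢0 = graftEach (w * (1/ totalWeight (subtreesAt 0 0 T)) {{≢-nonZero W≢0}}) T (subtreesAt 0 0 T)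

    module _ (h : ℕ → ℕ → ℚ) (k : ℚ) where

      graftEach-value : ∀ d T l → expectation (value h k 0 0) (graftEach d T l) ≡
        d * (valueOutside h k 0 0 T * totalWeight l + totalWeight (subtreesAt 0 0 T) * expectation (value h k x y) l)
      graftEach-value d T [] =
        solve 3 (λ d r W → con 0ℚ := d :* (r :* con 0ℚ :+ W :* con 0ℚ))
          refl d (valueOutside h k 0 0 T) (totalWeight (subtreesAt 0 0 T))
      graftEach-value d T ((u , X) ∷ l) rewrite value-graftAt h k X 0 0 T | graftEach-value d T l =
        solve 7 (λ d u r W v L e → d :* u :* (r :+ W :* v) :+ d :* (r :* L :+ W :* e)
                                    := d :* (r :* (u :* con 1ℚ :+ L) :+ W :* (u :* v :+ e)))
          refl d u (valueOutside h k 0 0 T) (totalWeight (subtreesAt 0 0 T)) (value h k x y X)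
               (totalWeight l) (expectation (value h k x y) l)

      mixAt-value : ∀ wT → expectation (value h k 0 0) (mixAt wT) ≡ proj₁ wT * value h k 0 0 (proj₂ wT)
      mixAt-value (w , T) with totalWeight (subtreesAt 0 0 T) ℚ.≟ 0ℚ
      ... | yes W≡0 = begin
        w * value h k 0 0 (graftAt leaf 0 0 T) + 0ℚ  ≡⟨ cong (λ v → w * v + 0ℚ) (value-graftAt h k leaf 0 0 T) ⟩
        w * (r + W * h x y) + 0ℚ                     ≡⟨ cong (λ W → w * (r + W * h x y) + 0ℚ) W≡0 ⟩
        w * (r + 0ℚ * h x y) + 0ℚ                    ≡⟨ solve 3 (λ w r v → w :* (r :+ con 0ℚ :* v) :+ con 0ℚ
                                                                  := w :* (r :+ con 0ℚ)) refl w r (h x y) ⟩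
        w * (r + 0ℚ)                                 ≡⟨ cong (λ e → w * (r + e)) e≡0 ⟨
        w * (r + e)                                  ≡⟨ cong (w *_) (value-split h k 0 0 T) ⟨
        w * value h k 0 0 T                          ∎
        where
        open ≡-Reasoning
        W = totalWeight (subtreesAt 0 0 T)
        r = valueOutside h k 0 0 T
        e = expectation (value h k x y) (subtreesAt 0 0 T)
        e≡0 : e ≡ 0ℚ
        e≡0 = expectation-weightless (value h k x y) (subtreesAt-nonNeg p∈[0,1] 0 0 T) W≡0
      ... | no W≢0 = begin
        expectation (value h k 0 0) (graftEach (w * W⁻¹) T (subtreesAt 0 0 T))
                                   ≡⟨ graftEach-value (w * W⁻¹) T (subtreesAt 0 0 T) ⟩
        w * W⁻¹ * (r * W + W * e)  ≡⟨ solve 5 (λ w c r W e → w :* c :* (r :* W :+ W :* e)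
                                                          := w :* (W :* c) :* (r :+ e)) refl w W⁻¹ r W e ⟩
        w * (W * W⁻¹) * (r + e)    ≡⟨ cong (λ z → w * z * (r + e)) (ℚ.*-inverseʳ W {{≢-nonZero W≢0}}) ⟩
        w * 1ℚ * (r + e)           ≡⟨ cong (_* (r + e)) (ℚ.*-identityʳ w) ⟩
        w * (r + e)                ≡⟨ cong (w *_) (value-split h k 0 0 T) ⟨
        w * value h k 0 0 T        ∎
        where
        open ≡-Reasoning
        W = totalWeight (subtreesAt 0 0 T)
        W⁻¹ = (1/ W) {{≢-nonZero W≢0}}
        r = valueOutside h k 0 0 T
        e = expectation (value h k x y) (subtreesAt 0 0 T)

    setRule : (ℕ → ℕ → Bool) → Bool → ℕ → ℕ → Bool
    setRule r s x′ y′ with onLayer? x′ y′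
    ... | yes _ = s
    ... | no _  = r x′ y′

    graftAt-uniformOn : ∀ {done} X T r → UniformBy r done 0 0 T →
      (∀ {x′ y′} → (x′ , y′) ∈ done → ¬ (x′ ≡ x × y′ ≡ y) →
                   UniformAt x′ y′ (r x′ y′) x y X) →
      UniformOn ((x , y) ∷ done) (graftAt X 0 0 T)
    graftAt-uniformOn {done} X T r uT uX = setRule r (isLeaf X) , uniform
      where
      uniform : UniformBy (setRule r (isLeaf X)) ((x , y) ∷ done) 0 0 (graftAt X 0 0 T)
      uniform {x′} {y′} m with onLayer? x′ y′
      ... | yes (refl , refl) = graftAt-uniformizes X 0 0 T
      ... | no off with m
      ...   | here refl = contradiction (refl , refl) off
      ...   | there m′  = graftAt-preserves-uniformAt X 0 0 T (uX m′ off) (uT m′)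

    mixAt-admissible : ∀ {done} wT → Admissible done wT → All (Admissible ((x , y) ∷ done)) (mixAt wT)
    mixAt-admissible {done} (w , T) (0≤w , T≼S , r , uT) with totalWeight (subtreesAt 0 0 T) ℚ.≟ 0ℚ
    ... | yes _ =
        ( 0≤w
        , graftAt-prunes g 0 0 T (λ _ → stop) eS T≼S
        , graftAt-uniformOn leaf T r uT (λ _ off on → contradiction (sym (proj₁ on) , sym (proj₂ on)) off))
      ∷ []
    ... | no W≢0 =
      map⁺ (All.map (λ { (0≤u , X≼ , uX) → *-nonNeg 0≤d 0≤u
                                           , graftAt-prunes g 0 0 T X≼ eS T≼S
                                           , graftAt-uniformOn _ T r uT (λ m _ → uX m) })
                    (All.zip ( subtreesAt-nonNeg p∈[0,1] 0 0 T
                             , All.zip ( subtreesAt-prunes g 0 0 T (_ , eS , T≼S)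
                                       , subtreesAt-inherit (UniformBy r done) uniformBy-children 0 0 T uT))))
      where
      W = totalWeight (subtreesAt 0 0 T)
      0≤d : 0ℚ ≤ w * (1/ W) {{≢-nonZero W≢0}}
      0≤d = *-nonNeg 0≤w (1/-nonNeg W≢0 (totalWeight-nonNeg (subtreesAt-nonNeg p∈[0,1] 0 0 T)))

  mixLayers : List (ℕ × ℕ) → List (ℚ × Tree n) → List (ℚ × Tree n)
  mixLayers []             m = m
  mixLayers ((x , y) ∷ ls) m = concatMap (mixAt x y) (mixLayers ls m)

  mixLayers-value : ∀ h k ls m → expectation (value h k 0 0) (mixLayers ls m) ≡ expectation (value h k 0 0) m
  mixLayers-value h k []             m = refl
  mixLayers-value h k ((x , y) ∷ ls) m =
    trans (expectation-concatMap _ (mixAt x y) (mixAt-value x y h k) (mixLayers ls m)) (mixLayers-value h k ls m)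

  mixLayers-admissible : ∀ ls {m} → All (Admissible []) m → All (Admissible ls) (mixLayers ls m)
  mixLayers-admissible []             adm = adm
  mixLayers-admissible ((x , y) ∷ ls) adm =
    concat⁺ (map⁺ (All.map (mixAt-admissible x y _) (mixLayers-admissible ls adm)))

  mixLayers-expectation : ∀ {F} h k → (∀ {T} → Prunes T S → F T ≡ value h k 0 0 T) →
                          ∀ ls {m} → All (Admissible []) m → expectation F (mixLayers ls m) ≡ expectation F m
  mixLayers-expectation {F} h k F≡value ls {m} adm = begin
    expectation F (mixLayers ls m)               ≡⟨ expectation-cong _ (onPrunings (mixLayers-admissible ls adm)) ⟩
    expectation (value h k 0 0) (mixLayers ls m) ≡⟨ mixLayers-value h k ls m ⟩
    expectation (value h k 0 0) m                ≡⟨ expectation-cong _ (onPrunings adm) ⟨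
    expectation F m                              ∎
    where
    open ≡-Reasoning
    onPrunings : ∀ {ls m} → All (Admissible ls) m → All (λ wT → F (proj₂ wT) ≡ value h k 0 0 (proj₂ wT)) m
    onPrunings = All.map (F≡value ∘ proj₁ ∘ proj₂)

count0 count1 stars : ∀ {m} → PartialAssignment m → ℕ
count0 []               = 0
count0 (just false ∷ σ) = suc (count0 σ)
count0 (just true  ∷ σ) = count0 σ
count0 (nothing    ∷ σ) = count0 σ
count1 []               = 0
count1 (just false ∷ σ) = count1 σ
count1 (just true  ∷ σ) = suc (count1 σ)
count1 (nothing    ∷ σ) = count1 σ
stars []           = 0
stars (just _  ∷ σ) = stars σ
stars (nothing ∷ σ) = suc (stars σ)

counts-total : ∀ {m} (σ : PartialAssignment m) → count0 σ ℕ.+ count1 σ ℕ.+ stars σ ≡ m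
counts-total []               = refl
counts-total (just false ∷ σ) = cong suc (counts-total σ)
counts-total (just true  ∷ σ) =
  trans (cong (ℕ._+ stars σ) (ℕ.+-suc (count0 σ) (count1 σ))) (cong suc (counts-total σ))
counts-total (nothing    ∷ σ) = trans (ℕ.+-suc (count0 σ ℕ.+ count1 σ) (stars σ)) (cong suc (counts-total σ))

stars-determined : ∀ {m} (σ σ′ : PartialAssignment m) → count0 σ ≡ count0 σ′ → count1 σ ≡ count1 σ′ →
                   stars σ ≡ stars σ′
stars-determined σ σ′ c0≡ c1≡ = ℕ.+-cancelˡ-≡ (count0 σ ℕ.+ count1 σ) (stars σ) (stars σ′)
  (trans (counts-total σ) (sym (trans (cong₂ (λ u v → u ℕ.+ v ℕ.+ stars σ′) c0≡ c1≡) (counts-total σ′))))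

extension-ones : ∀ {m} {x : Vec Bool m} {σ} → Extends x σ →
                 Σ ℕ λ k → k ℕ.≤ stars σ × ones x ≡ count1 σ ℕ.+ k
extension-ones [] = 0 , z≤n , refl
extension-ones {x = true ∷ x} {nothing ∷ σ} (_ ∷ x⊒σ) with extension-ones x⊒σ
... | k , k≤ , ones≡ = suc k , s≤s k≤ , trans (cong suc ones≡) (sym (ℕ.+-suc (count1 σ) k))
extension-ones {x = false ∷ x} {nothing ∷ σ} (_ ∷ x⊒σ) with extension-ones x⊒σ
... | k , k≤ , ones≡ = k , ℕ.m≤n⇒m≤1+n k≤ , ones≡
extension-ones {x = true ∷ x} {just true ∷ σ} (_ ∷ x⊒σ) with extension-ones x⊒σ
... | k , k≤ , ones≡ = k , k≤ , cong suc ones≡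
extension-ones {x = false ∷ x} {just false ∷ σ} (_ ∷ x⊒σ) = extension-ones x⊒σ

extension-with-ones : ∀ {m} (σ : PartialAssignment m) k → k ℕ.≤ stars σ →
                      Σ (Vec Bool m) λ x → Extends x σ × ones x ≡ count1 σ ℕ.+ k
extension-with-ones [] zero z≤n = [] , [] , refl
extension-with-ones (nothing ∷ σ) zero _ with extension-with-ones σ zero z≤n
... | x , x⊒σ , ones≡ = false ∷ x , tt ∷ x⊒σ , ones≡
extension-with-ones (nothing ∷ σ) (suc k) (s≤s k≤) with extension-with-ones σ k k≤
... | x , x⊒σ , ones≡ = true ∷ x , tt ∷ x⊒σ , trans (cong suc ones≡) (sym (ℕ.+-suc (count1 σ) k))
extension-with-ones (just true ∷ σ) k k≤ with extension-with-ones σ k k≤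
... | x , x⊒σ , ones≡ = true ∷ x , refl ∷ x⊒σ , cong suc ones≡
extension-with-ones (just false ∷ σ) k k≤ with extension-with-ones σ k k≤
... | x , x⊒σ , ones≡ = false ∷ x , refl ∷ x⊒σ , ones≡

utility-cong : ∀ {n} (f : Vec Bool n → Bool) L {σ σ′} →
               (∀ ℓ → IsCertificate f ℓ σ → IsCertificate f ℓ σ′) →
               (∀ ℓ → IsCertificate f ℓ σ′ → IsCertificate f ℓ σ) →
               utility f L σ ≡ utility f L σ′
utility-cong f L {σ} {σ′} to from
  with isCertificate? f false σ | isCertificate? f false σ′ | isCertificate? f true σ | isCertificate? f true σ′
... | yes c | no ¬c′ | _     | _      = contradiction (to false c) ¬c′
... | no ¬c | yes c′ | _     | _      = contradiction (from false c′) ¬c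
... | _     | _      | yes c | no ¬c′ = contradiction (to true c) ¬c′
... | _     | _      | no ¬c | yes c′ = contradiction (from true c′) ¬c
... | yes _ | yes _  | yes _ | yes _  = refl
... | yes _ | yes _  | no _  | no _   = refl
... | no _  | no _   | yes _ | yes _  = refl
... | no _  | no _   | no _  | no _   = refl

module _ {n} {f : Vec Bool n → Bool} (symmetric : Symmetric f) where

  -- The extensions of σ realise exactly the numbers of ones count1 σ + k with k ≤ stars σ.
  isCertificate-counts : ∀ ℓ {σ σ′} → count0 σ ≡ count0 σ′ → count1 σ ≡ count1 σ′ →
                         IsCertificate f ℓ σ → IsCertificate f ℓ σ′
  isCertificate-counts ℓ {σ} {σ′} c0≡ c1≡ cert x x⊒σ′ with extension-ones x⊒σ′
  ... | k , k≤ , ones-x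
    with extension-with-ones σ k (subst (k ℕ.≤_) (sym (stars-determined σ σ′ c0≡ c1≡)) k≤)
  ... | x′ , x′⊒σ , ones-x′ =
    trans (symmetric x x′ (trans ones-x (trans (cong (ℕ._+ k) (sym c1≡)) (sym ones-x′)))) (cert x′ x′⊒σ)

  utility-counts : ∀ L {σ σ′} → count0 σ ≡ count0 σ′ → count1 σ ≡ count1 σ′ →
                   utility f L σ ≡ utility f L σ′
  utility-counts L c0≡ c1≡ = utility-cong f L (λ ℓ → isCertificate-counts ℓ c0≡ c1≡)
                                              (λ ℓ → isCertificate-counts ℓ (sym c0≡) (sym c1≡))

-- a zeros, then b ones, then stars: a representative of layer (a , b) when a + b ≤ m
layerAssignment : ∀ m → ℕ → ℕ → PartialAssignment m
layerAssignment zero    _       _       = []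
layerAssignment (suc m) (suc a) b       = just false ∷ layerAssignment m a b
layerAssignment (suc m) zero    (suc b) = just true ∷ layerAssignment m zero b
layerAssignment (suc m) zero    zero    = nothing ∷ layerAssignment m zero zero

layerAssignment-counts : ∀ m a b → a ℕ.+ b ℕ.≤ m →
                         count0 (layerAssignment m a b) ≡ a × count1 (layerAssignment m a b) ≡ b
layerAssignment-counts zero    zero    zero    _       = refl , refl
layerAssignment-counts (suc m) (suc a) b       (s≤s ≤m) =
  Product.map₁ (cong suc) (layerAssignment-counts m a b ≤m)
layerAssignment-counts (suc m) zero    (suc b) (s≤s ≤m) =
  Product.map₂ (cong suc) (layerAssignment-counts m zero b ≤m)
layerAssignment-counts (suc m) zero    zero    _       = layerAssignment-counts m zero zero z≤n

replicate-nothing-counts : ∀ m → count0 (replicate m nothing) ≡ 0 × count1 (replicate m nothing) ≡ 0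
replicate-nothing-counts zero    = refl , refl
replicate-nothing-counts (suc m) = replicate-nothing-counts m

count-set-false : ∀ {m} (σ : PartialAssignment m) i → lookup σ i ≡ nothing →
                  count0 (σ [ i ]≔ just false) ≡ suc (count0 σ) × count1 (σ [ i ]≔ just false) ≡ count1 σ
count-set-false (nothing ∷ σ)    Fin.zero    _  = refl , refl
count-set-false (nothing ∷ σ)    (Fin.suc i) σi = count-set-false σ i σi
count-set-false (just false ∷ σ) (Fin.suc i) σi = Product.map₁ (cong suc) (count-set-false σ i σi)
count-set-false (just true ∷ σ)  (Fin.suc i) σi = Product.map₂ (cong suc) (count-set-false σ i σi)

count-set-true : ∀ {m} (σ : PartialAssignment m) i → lookup σ i ≡ nothing →
                 count0 (σ [ i ]≔ just true) ≡ count0 σ × count1 (σ [ i ]≔ just true) ≡ suc (count1 σ)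
count-set-true (nothing ∷ σ)    Fin.zero    _  = refl , refl
count-set-true (nothing ∷ σ)    (Fin.suc i) σi = count-set-true σ i σi
count-set-true (just false ∷ σ) (Fin.suc i) σi = Product.map₁ (cong suc) (count-set-true σ i σi)
count-set-true (just true ∷ σ)  (Fin.suc i) σi = Product.map₂ (cong suc) (count-set-true σ i σi)

module _ {n} (p : Fin n → ℚ) where
  open Layered p

  Unassigned : PartialAssignment n → List (Fin n) → Set
  Unassigned σ used = ∀ j → ¬ (j ∈ used) → lookup σ j ≡ nothing

  unassigned-set : ∀ {used} σ i v → Unassigned σ used → Unassigned (σ [ i ]≔ v) (i ∷ used)
  unassigned-set σ i v unassigned j j∉ =
    trans (lookup∘updateAt′ j i (j∉ ∘ here) σ) (unassigned j (j∉ ∘ there))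

  expUtilFrom≡value : ∀ {U h} → (∀ σ → U σ ≡ h (count0 σ) (count1 σ)) →
                      ∀ {σ used} t → ValidFrom used t → Unassigned σ used →
                      expUtilFrom p U σ t ≡ value h 0ℚ (count0 σ) (count1 σ) t
  expUtilFrom≡value U≡h {σ} leaf           _ _ = U≡h σ
  expUtilFrom≡value {U} {h} U≡h {σ} (node i t₀ t₁) (i∉ , valid₀ , valid₁) unassigned =
    trans (cong₂ (λ u v → (1ℚ - p i) * u + p i * v) after0 after1) (sym (ℚ.+-identityˡ _))
    where
    σi≡* = unassigned i i∉
    after0 : expUtilFrom p U (σ [ i ]≔ just false) t₀ ≡ value h 0ℚ (suc (count0 σ)) (count1 σ) t₀
    after0 = trans (expUtilFrom≡value U≡h t₀ valid₀ (unassigned-set σ i (just false) unassigned))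
                   (value-cong t₀ (count-set-false σ i σi≡*))
    after1 : expUtilFrom p U (σ [ i ]≔ just true) t₁ ≡ value h 0ℚ (count0 σ) (suc (count1 σ)) t₁
    after1 = trans (expUtilFrom≡value U≡h t₁ valid₁ (unassigned-set σ i (just true) unassigned))
                   (value-cong t₁ (count-set-true σ i σi≡*))

  expUtil≡value : ∀ {f : Vec Bool n → Bool} → Symmetric f → ∀ L {T} → Valid T →
                  expUtilFrom p (utility f L) (replicate n nothing) T ≡
                  value (λ a b → utility f L (layerAssignment n a b)) 0ℚ 0 0 T
  expUtil≡value {f} symmetric L {T} valid =
    trans (expUtilFrom≡value utility≡layer T valid (λ j _ → lookup-replicate j nothing))
          (value-cong T (replicate-nothing-counts n))
    where
    utility≡layer : ∀ σ → utility f L σ ≡ utility f L (layerAssignment n (count0 σ) (count1 σ))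
    utility≡layer σ = utility-counts symmetric L (sym (proj₁ counts)) (sym (proj₂ counts))
      where
      counts = layerAssignment-counts n (count0 σ) (count1 σ)
                  (subst (count0 σ ℕ.+ count1 σ ℕ.≤_) (counts-total σ) (ℕ.m≤m+n _ (stars σ)))

lemma1 : (n : ℕ) (p : Fin n → ℚ) → (∀ i → 0ℚ ≤ p i × p i ≤ 1ℚ) →
         (f : Vec Bool n → Bool) → Symmetric f → (L : Bool → Bool) →
         (S : Tree n) → Valid S → Elementary S →
         (R : RandPruning S) →
         Σ (RandPruning S) (λ R′ → ElementaryRand R′ ×
            ExpCost p R ≡ ExpCost p R′ × ExpUtil p f L R ≡ ExpUtil p f L R′)
lemma1 n p p∈[0,1] f symmetric L S valid (g , eS) R = R′ , elementary , sym cost≡ , sym utility≡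
  where
  open Layered p
  open Mixing p p∈[0,1] g eS

  layers = layersFrom 0 0 S
  mixed = mixLayers layers (support R)

  initial : All (Admissible []) (support R)
  initial = All.zipWith (λ (0≤w , T≼S) → 0≤w , T≼S , (λ _ _ → true) , λ ()) (nonneg R , isPruning R)

  admissible : All (Admissible layers) mixed
  admissible = mixLayers-admissible layers initial

  cost≡ = mixLayers-expectation (λ _ _ → 0ℚ) 1ℚ (λ {T} _ → expCostFrom≡value 0 0 T) layers initial
  utility≡ = mixLayers-expectation _ 0ℚ (λ T≼S → expUtil≡value p symmetric L (validFrom-prune T≼S valid))
                                    layers initial
  weight≡ = mixLayers-expectation (λ _ _ → 1ℚ) 0ℚ (λ {T} _ → sym (value-one 0 0 T)) layers initial

  R′ : RandPruning S
  R′ = record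
    { support   = mixed
    ; nonneg    = All.map proj₁ admissible
    ; total     = begin
        sumℚ (map proj₁ mixed)          ≡⟨ sumℚ-weights≡totalWeight mixed ⟩
        totalWeight mixed               ≡⟨ weight≡ ⟩
        totalWeight (support R)         ≡⟨ sumℚ-weights≡totalWeight (support R) ⟨
        sumℚ (map proj₁ (support R))    ≡⟨ total R ⟩
        1ℚ                              ∎
    ; isPruning = All.map (proj₁ ∘ proj₂) admissible
    }
    where open ≡-Reasoning

  elementary : ElementaryRand R′
  elementary = All.map (λ (_ , T≼S , r , uniform) → stopWhen r g , elemFrom-stopWhen T≼S eS uniform) admissible
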